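{- Let $d\in\mathbb{Z}_{\ge1}$ and $\gamma\in\mathbb{Z}_{\ge2}$. Consider any integer assignment of the variables $x^{\mathrm{bin}}(\ell),y(\ell),z(\ell)$ ($\ell\in\{0,\dots,d-1\}$) and $r(\ell)$ ($\ell\in\{0,\dots,d\}$) satisfying the constraint system $\mathcal{S}_{d,\gamma}$ described in the context. If $r(d)=\gamma^i$ for some $i\in\mathbb{Z}_{\ge1}$ with $\gamma^i\le\gamma^{2^d-1}$, then $x^{\mathrm{bin}}$ is the binary encoding of $i$, i.e. $i=\sum_{\ell=0}^{d-1}2^\ell x^{\mathrm{bin}}(\ell)$.
   Context: The constraint system $\mathcal{S}_{d,\gamma}$ consists of, for each $\ell\in\{0,\dots,d-1\}$: $y(\ell)\ge0$; $y(\ell)\le r(\ell+1)/\gamma^{2^\ell}+1/(\gamma^{2^\ell}+1)$; $y(\ell)\ge r(\ell+1)/\gamma^{2^\ell}-(\gamma^{2^\ell}-1)/\gamma^{2^\ell}$; $x^{\mathrm{bin}}(\ell)\ge0$; $x^{\mathrm{bin}}(\ell)\le1$; $x^{\mathrm{bin}}(\ell)\le y(\ell)$; $y(\ell)\le(\gamma^{2^\ell}+1)x^{\mathrm{bin}}(\ell)$; $r(\ell)\ge0$; $(\gamma^{2^\ell}-1)z(\ell)+r(\ell)=r(\ell+1)$; $z(\ell)\ge0$; $z(\ell)\ge-\gamma^{2^\ell}+\gamma^{2^\ell}x^{\mathrm{bin}}(\ell)+r(\ell)$; $z(\ell)\le\gamma^{2^\ell}x^{\mathrm{bin}}(\ell)$;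 $z(\ell)\le r(\ell)$; together with the three constraints $r(0)=1$, $r(d)\ge2$, $r(d)\le\gamma^{2^d-1}$. All variables are required to be integers. -}

module Defs where

open import Data.Nat as ℕ using (ℕ; zero; suc; _∸_)
open import Data.Integer using (ℤ; +_; _+_; _-_; _*_; _≤_)
open import Data.Product using (_×_)
open import Relation.Binary.PropositionalEquality using (_≡_)

gpow : ℕ → ℕ → ℤ
gpow γ ℓ = + (γ ℕ.^ (2 ℕ.^ ℓ))

-- The two constraints with fractions are multiplied by the positive
-- denominators (g = γ^(2^ℓ) ≥ 1):
--   y ≤ r(ℓ+1)/g + 1/(g+1)         ⇔  g(g+1) y ≤ (g+1) r(ℓ+1) + g
--   y ≥ r(ℓ+1)/g - (g-1)/g         ⇔  g y ≥ r(ℓ+1) - (g - 1)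
LevelConstraints : ℕ → (x y z r : ℕ → ℤ) → ℕ → Set
LevelConstraints γ x y z r ℓ =
  let g = gpow γ ℓ in
    (+ 0 ≤ y ℓ)
  × (g * (g + + 1) * y ℓ ≤ (g + + 1) * r (suc ℓ) + g)
  × (r (suc ℓ) - (g - + 1) ≤ g * y ℓ)
  × (+ 0 ≤ x ℓ)
  × (x ℓ ≤ + 1)
  × (x ℓ ≤ y ℓ)
  × (y ℓ ≤ (g + + 1) * x ℓ)
  × (+ 0 ≤ r ℓ)
  × ((g - + 1) * z ℓ + r ℓ ≡ r (suc ℓ))
  × (+ 0 ≤ z ℓ)
  × (- g + g * x ℓ + r ℓ ≤ z ℓ)
  × (z ℓ ≤ g * x ℓ)
  × (z ℓ ≤ r ℓ)
  where open import Data.Integer using (-_)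

-- The full system S_{d,γ}; variables are integer-valued functions of the
-- level (x, y, z are only constrained on ℓ < d, r on ℓ ≤ d).
System : ℕ → ℕ → (x y z r : ℕ → ℤ) → Set
System d γ x y z r =
    (∀ ℓ → ℓ ℕ.< d → LevelConstraints γ x y z r ℓ)
  × (r 0 ≡ + 1)
  × (+ 2 ≤ r d)
  × (r d ≤ + (γ ℕ.^ ((2 ℕ.^ d) ∸ 1)))

binSum : ℕ → (ℕ → ℤ) → ℤ
binSum zero    x = + 0
binSum (suc d) x = binSum d x + (+ (2 ℕ.^ d)) * x d

{-# OPTIONS --safe #-}
module Submission where

-- Each level multiplies r by γ^(2^ℓ) exactly when the bit x(ℓ) is 1: the
-- McCormick-type bounds on z pin z(ℓ) to 0 if x(ℓ) = 0 and to r(ℓ) if x(ℓ) = 1,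
-- so r(ℓ+1) = (γ^(2^ℓ) - 1) z(ℓ) + r(ℓ) is r(ℓ) or γ^(2^ℓ) r(ℓ). Starting from
-- r(0) = 1 this gives r(d) = γ^(Σ 2^ℓ x(ℓ)), and γ^i = γ^n forces i = n for γ ≥ 2.

open import Defs
open import Data.Nat using (ℕ; _≤_; _^_; _∸_)
open import Data.Integer using (ℤ; +_)
open import Relation.Binary.PropositionalEquality using (_≡_)

import Data.Nat as ℕ
import Data.Nat.Properties as ℕ
open import Data.Integer using (_+_; _-_; _*_; -_)
import Data.Integer as ℤ
import Data.Integer.Properties as ℤ
open import Data.Integer.Solver using (module +-*-Solver)
open import Data.Product using (∃-syntax; _×_; _,_)
open import Data.Sum using (_⊎_; inj₁; inj₂)
open import Data.Empty using (⊥-elim)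
open import Relation.Binary using (tri<; tri≈; tri>)
open import Relation.Binary.PropositionalEquality using (refl; sym; trans; cong; subst; module ≡-Reasoning)

^-injective : ∀ {m} → 1 ℕ.< m → ∀ {a b} → m ^ a ≡ m ^ b → a ≡ b
^-injective {m} 1<m {a} {b} eq with ℕ.<-cmp a b
... | tri< a<b _ _ = ⊥-elim (ℕ.<-irrefl eq (ℕ.^-monoʳ-< m 1<m a<b))
... | tri≈ _ a≡b _ = a≡b
... | tri> _ _ b<a = ⊥-elim (ℕ.<-irrefl (sym eq) (ℕ.^-monoʳ-< m 1<m b<a))

bit-cases : ∀ {a} → + 0 ℤ.≤ a → a ℤ.≤ + 1 → a ≡ + 0 ⊎ a ≡ + 1
bit-cases {+ 0}               _  _                    = inj₁ refl
bit-cases {+ 1}               _  _                    = inj₂ refl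
bit-cases {+ ℕ.suc (ℕ.suc _)} _  (ℤ.+≤+ (ℕ.s≤s ()))
bit-cases {ℤ.-[1+ _ ]}        ()

update-at-zero : ∀ g r → (g - + 1) * + 0 + r ≡ r
update-at-zero = solve 2 (λ g r → (g :- con (+ 1)) :* con (+ 0) :+ r := r) refl
  where open +-*-Solver

update-at-r : ∀ g r → (g - + 1) * r + r ≡ g * r
update-at-r = solve 2 (λ g r → (g :- con (+ 1)) :* r :+ r := g :* r) refl
  where open +-*-Solver

lower-bound-at-one : ∀ g r → - g + g * + 1 + r ≡ r
lower-bound-at-one = solve 2 (λ g r → :- g :+ g :* con (+ 1) :+ r := r) refl
  where open +-*-Solver

level-step : ∀ {γ x y z r ℓ} → LevelConstraints γ x y z r ℓ →
               (x ℓ ≡ + 0 × r (ℕ.suc ℓ) ≡ r ℓ)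
             ⊎ (x ℓ ≡ + 1 × r (ℕ.suc ℓ) ≡ gpow γ ℓ * r ℓ)
level-step {γ} {x} {_} {z} {r} {ℓ} (_ , _ , _ , x≥0 , x≤1 , _ , _ , _ , update , z≥0 , z≥lower , z≤gx , z≤r)
  with bit-cases x≥0 x≤1
... | inj₁ x≡0 = inj₁ (x≡0 , (begin
    r (ℕ.suc ℓ)           ≡⟨ sym update ⟩
    (g - + 1) * z ℓ + r ℓ ≡⟨ cong (λ t → (g - + 1) * t + r ℓ) z≡0 ⟩
    (g - + 1) * + 0 + r ℓ ≡⟨ update-at-zero g (r ℓ) ⟩
    r ℓ                   ∎))
  where
  open ≡-Reasoning
  g = gpow γ ℓ
  z≡0 : z ℓ ≡ + 0
  z≡0 = ℤ.≤-antisym (subst (z ℓ ℤ.≤_) (trans (cong (g *_) x≡0) (ℤ.*-zeroʳ g)) z≤gx) z≥0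
... | inj₂ x≡1 = inj₂ (x≡1 , (begin
    r (ℕ.suc ℓ)           ≡⟨ sym update ⟩
    (g - + 1) * z ℓ + r ℓ ≡⟨ cong (λ t → (g - + 1) * t + r ℓ) z≡r ⟩
    (g - + 1) * r ℓ + r ℓ ≡⟨ update-at-r g (r ℓ) ⟩
    g * r ℓ               ∎))
  where
  open ≡-Reasoning
  g = gpow γ ℓ
  z≡r : z ℓ ≡ r ℓ
  z≡r = ℤ.≤-antisym z≤r
    (subst (ℤ._≤ z ℓ) (trans (cong (λ t → - g + g * t + r ℓ) x≡1) (lower-bound-at-one g (r ℓ))) z≥lower)

binSum-suc-bit0 : ∀ {x k n} → binSum k x ≡ + n → x k ≡ + 0 → binSum (ℕ.suc k) x ≡ + n
binSum-suc-bit0 {x} {k} {n} sum≡n x≡0 rewrite sum≡n | x≡0 =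
  trans (cong (_+_ (+ n)) (ℤ.*-zeroʳ (+ 2 ^ k))) (ℤ.+-identityʳ (+ n))

binSum-suc-bit1 : ∀ {x k n} → binSum k x ≡ + n → x k ≡ + 1 → binSum (ℕ.suc k) x ≡ + (n ℕ.+ 2 ^ k)
binSum-suc-bit1 {x} {k} {n} sum≡n x≡1 rewrite sum≡n | x≡1 =
  cong (_+_ (+ n)) (ℤ.*-identityʳ (+ 2 ^ k))

gpow-*-pow : ∀ γ k n → gpow γ k * + (γ ^ n) ≡ + (γ ^ (n ℕ.+ 2 ^ k))
gpow-*-pow γ k n = begin
  + (γ ^ 2 ^ k) * + (γ ^ n)  ≡⟨ ℤ.pos-* (γ ^ 2 ^ k) (γ ^ n) ⟨
  + (γ ^ 2 ^ k ℕ.* γ ^ n)    ≡⟨ cong +_ (ℕ.*-comm (γ ^ 2 ^ k) (γ ^ n)) ⟩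
  + (γ ^ n ℕ.* γ ^ 2 ^ k)    ≡⟨ cong +_ (ℕ.^-distribˡ-+-* γ n (2 ^ k)) ⟨
  + (γ ^ (n ℕ.+ 2 ^ k))      ∎
  where open ≡-Reasoning

r≡γ^binSum : ∀ {d γ x y z r} → System d γ x y z r →
             ∀ k → k ≤ d → ∃[ n ] binSum k x ≡ + n × r k ≡ + (γ ^ n)
r≡γ^binSum (_ , r0≡1 , _) ℕ.zero _ = 0 , refl , r0≡1
r≡γ^binSum {d} {γ} {x} {y} {z} {r} S@(levels , _) (ℕ.suc k) k<d
  with r≡γ^binSum S k (ℕ.<⇒≤ k<d) | level-step {γ} {x} {y} {z} {r} (levels k k<d)
... | n , sum≡n , rk≡γ^n | inj₁ (x≡0 , r′≡r) =
  n , binSum-suc-bit0 {x} sum≡n x≡0 , trans r′≡r rk≡γ^n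
... | n , sum≡n , rk≡γ^n | inj₂ (x≡1 , r′≡gr) =
  n ℕ.+ 2 ^ k , binSum-suc-bit1 {x} sum≡n x≡1 ,
  trans r′≡gr (trans (cong (gpow γ k *_) rk≡γ^n) (gpow-*-pow γ k n))

lemma7 : (d γ : ℕ) → 1 ≤ d → 2 ≤ γ →
         (x y z r : ℕ → ℤ) → System d γ x y z r →
         (i : ℕ) → 1 ≤ i → γ ^ i ≤ γ ^ ((2 ^ d) ∸ 1) →
         r d ≡ + (γ ^ i) →
         + i ≡ binSum d x
lemma7 d γ _ 2≤γ x y z r S i _ _ rd≡γ^i
  with r≡γ^binSum S d ℕ.≤-refl
... | n , sum≡n , rd≡γ^n =
  trans (cong +_ (^-injective 2≤γ (ℤ.+-injective (trans (sym rd≡γ^i) rd≡γ^n)))) (sym sum≡n)
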